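{- Let $T$ be a tree with an even number of vertices. Then $mp_f(T)=mp(T)$.
   Context: For a graph $G$ with an even number of vertices, the matching preclusion number $mp(G)$ is the minimum number of edges whose deletion leaves a graph with no perfect matching. Let $\mathcal{M}(G)$ be the set of perfect matchings of $G$ and $\bm{q}^M\in\mathbb{R}^{E(G)}$ the incidence vector of $M$. The fractional matching preclusion number $mp_f(G)$ is the optimal value of the linear program: minimize $\bm{1}^T\bm{y}$ over $\bm{y}\in\mathbb{R}^{E(G)}$ subject to $(\bm{q}^M)^T\bm{y}\geqslant 1$ for every $M\in\mathcal{M}(G)$ and $\bm{y}\geqslant 0$.
   Formalization: In the linear program defining $mp_f$, the vector $\bm{y}$ ranges only over rational vectors rather than over $\mathbb{R}^{E(G)}$. -}

module Defs where

open import Data.Nat using (ℕ; zero; suc; _≤_; _+_)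
open import Data.Nat.Properties using ()
open import Data.Integer using (+_)
open import Data.Rational as ℚ using (ℚ; 0ℚ; 1ℚ)
open import Data.Bool using (Bool; true; false; _∧_)
open import Data.Fin using (Fin; zero; suc; inject₁; fromℕ)
open import Data.Product using (Σ; _×_; _,_; ∃; ∃-syntax; proj₁; proj₂)
open import Data.Sum using (_⊎_)
open import Relation.Nullary using (¬_)
open import Relation.Binary.PropositionalEquality using (_≡_; _≢_)
open import Data.Nat.Divisibility using (_∣_)

countB : ∀ {m} → (Fin m → Bool) → ℕ
countB {zero}  f = 0
countB {suc m} f = (if f zero then 1 else 0) + countB (λ i → f (suc i))
  where open import Data.Bool using (if_then_else_)

sumℚ : ∀ {m} → (Fin m → ℚ) → ℚ
sumℚ {zero}  f = 0ℚ
sumℚ {suc m} f = f zero ℚ.+ sumℚ (λ i → f (suc i))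

record Graph (n m : ℕ) : Set where
  field
    ends     : Fin m → Fin n × Fin n
    loopless : ∀ e → proj₁ (ends e) ≢ proj₂ (ends e)
    noMulti  : ∀ e f → proj₁ (ends e) ≡ proj₁ (ends f) × proj₂ (ends e) ≡ proj₂ (ends f)
                       ⊎ proj₁ (ends e) ≡ proj₂ (ends f) × proj₂ (ends e) ≡ proj₁ (ends f)
                     → e ≡ f
open Graph public

incident : ∀ {n m} → Graph n m → Fin n → Fin m → Bool
incident G v e with proj₁ (ends G e) Data.Fin.≟ v | proj₂ (ends G e) Data.Fin.≟ v
  where import Data.Fin
... | Relation.Nullary.yes _ | _ = true
... | Relation.Nullary.no _ | Relation.Nullary.yes _ = true
... | Relation.Nullary.no _ | Relation.Nullary.no _ = false

Adj : ∀ {n m} → Graph n m → Fin n → Fin n → Set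
Adj G u v = ∃[ e ] ((proj₁ (ends G e) ≡ u × proj₂ (ends G e) ≡ v)
                  ⊎ (proj₁ (ends G e) ≡ v × proj₂ (ends G e) ≡ u))

data Walk {n m} (G : Graph n m) : Fin n → Fin n → Set where
  here : ∀ {u} → Walk G u u
  step : ∀ {u v w} → Adj G u v → Walk G v w → Walk G u w

Connected : ∀ {n m} → Graph n m → Set
Connected G = ∀ u v → Walk G u v

record Cycle {n m} (G : Graph n m) : Set where
  field
    k        : ℕ
    c        : Fin (suc (suc (suc k))) → Fin n
    distinct : ∀ i j → c i ≡ c j → i ≡ j
    consec   : ∀ (i : Fin (suc (suc k))) → Adj G (c (inject₁ i)) (c (suc i))
    closing  : Adj G (c (fromℕ (suc (suc k)))) (c zero)

Acyclic : ∀ {n m} → Graph n m → Set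
Acyclic G = ¬ Cycle G

IsTree : ∀ {n m} → Graph n m → Set
IsTree {n} G = 1 ≤ n × Connected G × Acyclic G

IsPerfectMatching : ∀ {n m} → Graph n m → (Fin m → Bool) → Set
IsPerfectMatching G M = ∀ v → countB (λ e → M e ∧ incident G v e) ≡ 1

-- Deleting the edge set S leaves a graph with no perfect matching.
-- (Perfect matchings of G - S are exactly the perfect matchings of G
-- avoiding S.)
Precludes : ∀ {n m} → Graph n m → (Fin m → Bool) → Set
Precludes G S = ∀ M → IsPerfectMatching G M → ∃[ e ] (M e ≡ true × S e ≡ true)

IsMP : ∀ {n m} → Graph n m → ℕ → Set
IsMP G k = (∃[ S ] (Precludes G S × countB S ≡ k))
         × (∀ S → Precludes G S → k ≤ countB S)

dotInc : ∀ {m} → (Fin m → Bool) → (Fin m → ℚ) → ℚ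
dotInc M y = sumℚ (λ e → if M e then y e else 0ℚ)
  where open import Data.Bool using (if_then_else_)

FeasibleMPf : ∀ {n m} → Graph n m → (Fin m → ℚ) → Set
FeasibleMPf G y = (∀ M → IsPerfectMatching G M → 1ℚ ℚ.≤ dotInc M y)
                × (∀ e → 0ℚ ℚ.≤ y e)

IsMPf : ∀ {n m} → Graph n m → ℚ → Set
IsMPf G r = (∃[ y ] (FeasibleMPf G y × sumℚ y ≡ r))
          × (∀ y → FeasibleMPf G y → r ℚ.≤ sumℚ y)

ℕtoℚ : ℕ → ℚ
ℕtoℚ k = + k ℚ./ 1

Even : ℕ → Set
Even n = 2 ∣ n

-- If T has no perfect matching, both parameters are 0. Otherwise T, being
-- acyclic and having an edge, has a leaf: without vertices of degree one a
-- walk can always leave along an edge other than the one it arrived by, and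
-- the first vertex such a walk revisits closes a cycle. The pendant edge of
-- a leaf lies in every perfect matching, so {e} precludes them all and the
-- unit weight on e is LP-feasible; conversely any precluding set meets, and
-- any feasible weighting puts total weight 1 on, a fixed perfect matching.
-- Hence mp = mp_f = 1.
module Submission where

open import Defs
open import Data.Nat as ℕ using (ℕ; zero; suc; _+_; _≤_; _<_; z≤n; s≤s; anyUpTo?)
open import Data.Nat.Properties as ℕP using ()
open import Data.Nat.Induction using (<-wellFounded)
open import Induction.WellFounded using (Acc; acc)
open import Data.Fin as Fin using (Fin; zero; suc; toℕ; fromℕ<)
open import Data.Fin.Properties as FinP using (any?; all?)
open import Data.Fin.Subset.Properties using (anySubset?)
open import Data.Vec using (lookup; tabulate)
open import Data.Vec.Properties using (lookup∘tabulate)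
open import Data.Bool as Bool using (Bool; true; false; _∧_; if_then_else_)
open import Data.Bool.Properties using (∧-conicalˡ; ∧-conicalʳ)
open import Data.Rational as ℚ using (ℚ; 0ℚ; 1ℚ)
open import Data.Rational.Properties as ℚP using ()
open import Data.Product using (Σ; ∃; ∃₂; ∃-syntax; _×_; _,_; proj₁; proj₂)
open import Data.Sum using (_⊎_; inj₁; inj₂)
open import Data.Empty using (⊥-elim)
open import Relation.Nullary using (¬_; Dec; yes; no; does)
open import Relation.Nullary.Decidable using (_×-dec_; _→-dec_; dec-true)
open import Relation.Binary.Definitions using (tri<; tri≈; tri>)
open import Relation.Binary.PropositionalEquality

countB-cong : ∀ {m} {f g : Fin m → Bool} → (∀ x → f x ≡ g x) → countB f ≡ countB g
countB-cong {zero}  f≗g = refl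
countB-cong {suc m} f≗g rewrite f≗g zero =
  cong (λ c → _ + c) (countB-cong (λ x → f≗g (suc x)))

countB-false : ∀ {m} → countB {m} (λ _ → false) ≡ 0
countB-false {zero}  = refl
countB-false {suc m} = countB-false {m}

1≤countB : ∀ {m} {f : Fin m → Bool} e → f e ≡ true → 1 ≤ countB f
1≤countB         zero    fe rewrite fe = s≤s z≤n
1≤countB {f = f} (suc e) fe with f zero
... | true  = s≤s z≤n
... | false = 1≤countB e fe

countB≡1⇒∃ : ∀ {m} {f : Fin m → Bool} → countB f ≡ 1 → ∃ λ e → f e ≡ true
countB≡1⇒∃ {zero}      ()
countB≡1⇒∃ {suc m} {f} c with f zero in f0
... | true  = zero , f0
... | false = let e , fe = countB≡1⇒∃ c in suc e , fe

countB-singleton : ∀ {m} (e : Fin m) → countB (λ x → does (e Fin.≟ x)) ≡ 1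
countB-singleton {suc m} zero    = cong suc (countB-false {m})
countB-singleton         (suc e) = countB-singleton e

sumℚ-cong : ∀ {m} {f g : Fin m → ℚ} → (∀ x → f x ≡ g x) → sumℚ f ≡ sumℚ g
sumℚ-cong {zero}  f≗g = refl
sumℚ-cong {suc m} f≗g = cong₂ ℚ._+_ (f≗g zero) (sumℚ-cong (λ x → f≗g (suc x)))

sumℚ-mono : ∀ {m} {f g : Fin m → ℚ} → (∀ x → f x ℚ.≤ g x) → sumℚ f ℚ.≤ sumℚ g
sumℚ-mono {zero}  f≤g = ℚP.≤-refl
sumℚ-mono {suc m} f≤g = ℚP.+-mono-≤ (f≤g zero) (sumℚ-mono (λ x → f≤g (suc x)))

sumℚ-zero : ∀ {m} → sumℚ {m} (λ _ → 0ℚ) ≡ 0ℚ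
sumℚ-zero {zero}  = refl
sumℚ-zero {suc m} = trans (ℚP.+-identityˡ _) (sumℚ-zero {m})

sumℚ-nonneg : ∀ {m} {f : Fin m → ℚ} → (∀ x → 0ℚ ℚ.≤ f x) → 0ℚ ℚ.≤ sumℚ f
sumℚ-nonneg {m} {f} f≥0 = subst (ℚ._≤ sumℚ f) (sumℚ-zero {m}) (sumℚ-mono f≥0)

indicator : ∀ {m} → Fin m → Fin m → ℚ
indicator e x = if does (e Fin.≟ x) then 1ℚ else 0ℚ

indicator-nonneg : ∀ {m} (e x : Fin m) → 0ℚ ℚ.≤ indicator e x
indicator-nonneg e x with does (e Fin.≟ x)
... | true  = ℚP.nonNegative⁻¹ 1ℚ
... | false = ℚP.≤-refl

sumℚ-indicator : ∀ {m} (e : Fin m) → sumℚ (indicator e) ≡ 1ℚ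
sumℚ-indicator {suc m} zero    = trans (cong (1ℚ ℚ.+_) (sumℚ-zero {m})) (ℚP.+-identityʳ 1ℚ)
sumℚ-indicator         (suc e) = trans (ℚP.+-identityˡ _) (sumℚ-indicator e)

dotInc≤sumℚ : ∀ {m} (M : Fin m → Bool) {y : Fin m → ℚ} →
              (∀ e → 0ℚ ℚ.≤ y e) → dotInc M y ℚ.≤ sumℚ y
dotInc≤sumℚ M {y} y≥0 = sumℚ-mono termwise
  where
  termwise : ∀ x → (if M x then y x else 0ℚ) ℚ.≤ y x
  termwise x with M x
  ... | true  = ℚP.≤-refl
  ... | false = y≥0 x

dotInc-indicator : ∀ {m} (M : Fin m → Bool) {e} → M e ≡ true → dotInc M (indicator e) ≡ 1ℚ
dotInc-indicator M {e} Me = trans (sumℚ-cong termwise) (sumℚ-indicator e)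
  where
  termwise : ∀ x → (if M x then indicator e x else 0ℚ) ≡ indicator e x
  termwise x with e Fin.≟ x | M x in Mx
  ... | yes refl | true  = refl
  ... | yes refl | false with () ← trans (sym Me) Mx
  ... | no _     | true  = refl
  ... | no _     | false = refl

module _ {n m} (G : Graph n m) where

  Joins : Fin m → Fin n → Fin n → Set
  Joins e u v = (proj₁ (ends G e) ≡ u × proj₂ (ends G e) ≡ v)
              ⊎ (proj₁ (ends G e) ≡ v × proj₂ (ends G e) ≡ u)

  Joins-sym : ∀ {e u v} → Joins e u v → Joins e v u
  Joins-sym (inj₁ p) = inj₂ p
  Joins-sym (inj₂ p) = inj₁ p

  Joins-irrefl : ∀ {e u} → ¬ Joins e u u
  Joins-irrefl {e} (inj₁ (p , q)) = loopless G e (trans p (sym q))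
  Joins-irrefl {e} (inj₂ (p , q)) = loopless G e (trans p (sym q))

  Joins-injective : ∀ {e f u v} → Joins e u v → Joins f u v → e ≡ f
  Joins-injective {e} {f} (inj₁ (p , q)) (inj₁ (r , s)) = noMulti G e f (inj₁ (trans p (sym r) , trans q (sym s)))
  Joins-injective {e} {f} (inj₁ (p , q)) (inj₂ (r , s)) = noMulti G e f (inj₂ (trans p (sym s) , trans q (sym r)))
  Joins-injective {e} {f} (inj₂ (p , q)) (inj₁ (r , s)) = noMulti G e f (inj₂ (trans p (sym s) , trans q (sym r)))
  Joins-injective {e} {f} (inj₂ (p , q)) (inj₂ (r , s)) = noMulti G e f (inj₁ (trans p (sym r) , trans q (sym s)))

  Joins⇒incident : ∀ {e u v} → Joins e u v → incident G v e ≡ true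
  Joins⇒incident {e} {v = v} j with proj₁ (ends G e) Fin.≟ v | proj₂ (ends G e) Fin.≟ v
  ... | yes _ | _     = refl
  ... | no _  | yes _ = refl
  ... | no e₁≢v | no e₂≢v with j
  ...   | inj₁ (_ , e₂≡v) = ⊥-elim (e₂≢v e₂≡v)
  ...   | inj₂ (e₁≡v , _) = ⊥-elim (e₁≢v e₁≡v)

  incident⇒Joins : ∀ {v e} → incident G v e ≡ true → ∃ λ w → Joins e v w
  incident⇒Joins {v} {e} v∈e with proj₁ (ends G e) Fin.≟ v | proj₂ (ends G e) Fin.≟ v
  ... | yes e₁≡v | _        = _ , inj₁ (e₁≡v , refl)
  ... | no _     | yes e₂≡v = _ , inj₂ (refl , e₂≡v)

  record NonBacktrackingWalk : Set where
    field
      vertex          : ℕ → Fin n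
      edge            : ℕ → Fin m
      joins           : ∀ i → Joins (edge i) (vertex i) (vertex (suc i))
      nonBacktracking : ∀ i → edge (suc i) ≢ edge i

  drop : ℕ → NonBacktrackingWalk → NonBacktrackingWalk
  drop k W = record
    { vertex          = λ i → vertex (i + k)
    ; edge            = λ i → edge (i + k)
    ; joins           = λ i → joins (i + k)
    ; nonBacktracking = λ i → nonBacktracking (i + k)
    }
    where open NonBacktrackingWalk W

  module _ (W : NonBacktrackingWalk) where
    open NonBacktrackingWalk W

    Distinct< : ℕ → Set
    Distinct< j = ∀ a b → a < b → b < j → vertex a ≢ vertex b

    simpleClosedWalk⇒cycle : ∀ k → vertex 0 ≡ vertex (3 + k) → Distinct< (3 + k) → Cycle G
    simpleClosedWalk⇒cycle k closed distinctVertices = record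
      { k        = k
      ; c        = c
      ; distinct = distinct
      ; consec   = λ t → subst (λ i → Adj G (vertex i) (c (suc t))) (sym (FinP.toℕ-inject₁ t))
                           (_ , joins (toℕ t))
      ; closing  = subst₂ (λ i v → Adj G (vertex i) v) (sym (FinP.toℕ-fromℕ (2 + k))) (sym closed)
                     (_ , joins (2 + k))
      }
      where
      c : Fin (3 + k) → Fin n
      c t = vertex (toℕ t)
      distinct : ∀ t s → c t ≡ c s → t ≡ s
      distinct t s ct≡cs with ℕP.<-cmp (toℕ t) (toℕ s)
      ... | tri< t<s _ _ = ⊥-elim (distinctVertices _ _ t<s (FinP.toℕ<n s) ct≡cs)
      ... | tri≈ _ t≡s _ = FinP.toℕ-injective t≡s
      ... | tri> _ _ s<t = ⊥-elim (distinctVertices _ _ s<t (FinP.toℕ<n t) (sym ct≡cs))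

    -- Closed walks of length 1 and 2 are excluded by looplessness and by
    -- non-backtracking together with the absence of multiple edges.
    firstReturn⇒cycle : ∀ d → vertex 0 ≡ vertex (suc d) → Distinct< (suc d) → Cycle G
    firstReturn⇒cycle zero closed _ =
      ⊥-elim (Joins-irrefl (subst (Joins (edge 0) (vertex 0)) (sym closed) (joins 0)))
    firstReturn⇒cycle (suc zero) closed _ =
      ⊥-elim (nonBacktracking 0 (Joins-injective
        (Joins-sym (subst (Joins (edge 1) (vertex 1)) (sym closed) (joins 1))) (joins 0)))
    firstReturn⇒cycle (suc (suc k)) = simpleClosedWalk⇒cycle k

    Repeats : ℕ → Set
    Repeats j = ∃ λ i → i < j × vertex i ≡ vertex j

    firstRepeat : ∀ j → Acc _<_ j → Repeats j → ∃ λ j → Repeats j × (∀ b → b < j → ¬ Repeats b)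
    firstRepeat j (acc smaller) r
      with anyUpTo? (λ b → anyUpTo? (λ i → vertex i Fin.≟ vertex b) b) j
    ... | yes (b , b<j , rb) = firstRepeat b (smaller b<j) rb
    ... | no none            = j , r , λ b b<j rb → none (b , b<j , rb)

    someVertexRepeats : ∃ Repeats
    someVertexRepeats =
      let i , j , i<j , same = FinP.pigeonhole (ℕP.n<1+n n) (λ t → vertex (toℕ t))
      in toℕ j , toℕ i , i<j , same

  module _ (W : NonBacktrackingWalk) where
    open NonBacktrackingWalk W

    walk⇒cycle : Cycle G
    walk⇒cycle with firstRepeat W _ (<-wellFounded _) (proj₂ (someVertexRepeats W))
    ... | j , (i , i<j , same) , first with ℕP.m≤n⇒∃[o]m+o≡n i<j
    ...   | d , refl = firstReturn⇒cycle (drop i W) d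
                         (trans same (cong (λ k → vertex (suc k)) (ℕP.+-comm i d)))
                         distinct
      where
      distinct : ∀ a b → a < b → b < suc d → vertex (a + i) ≢ vertex (b + i)
      distinct a b a<b b<d+1 same′ =
        first (b + i) (subst (b + i <_) (cong suc (ℕP.+-comm d i)) (ℕP.+-monoˡ-< i b<d+1))
          (a + i , ℕP.+-monoˡ-< i a<b , same′)

  PendantEdge : Fin n → Fin m → Set
  PendantEdge v e = incident G v e ≡ true × (∀ f → incident G v f ≡ true → f ≡ e)

  pendantEdge? : ∀ v e → Dec (PendantEdge v e)
  pendantEdge? v e = (incident G v e Bool.≟ true)
    ×-dec all? (λ f → (incident G v f Bool.≟ true) →-dec (f Fin.≟ e))

  anotherEdge : ∀ {v e} → incident G v e ≡ true → ¬ PendantEdge v e →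
                ∃ λ f → incident G v f ≡ true × f ≢ e
  anotherEdge {v} {e} v∈e notPendant
    with FinP.¬∀⟶∃¬ m _ (λ f → (incident G v f Bool.≟ true) →-dec (f Fin.≟ e))
                         (λ onlyE → notPendant (v∈e , onlyE))
  ... | f , notOnlyE with incident G v f Bool.≟ true
  ...   | yes v∈f = f , v∈f , λ f≡e → notOnlyE (λ _ → f≡e)
  ...   | no  v∉f = ⊥-elim (notOnlyE (λ v∈f → ⊥-elim (v∉f v∈f)))

  -- A dart is the current vertex together with the edge the walk arrived by.
  Dart : Set
  Dart = Σ (Fin n) λ v → Σ (Fin m) λ e → incident G v e ≡ true

  leaflessWalk : (∀ v e → ¬ PendantEdge v e) → Dart → NonBacktrackingWalk
  leaflessWalk leafless start = record
    { vertex          = λ i → proj₁ (dart i)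
    ; edge            = λ i → proj₁ (proj₂ (dart (suc i)))
    ; joins           = λ i → proj₁ (proj₂ (next (dart i)))
    ; nonBacktracking = λ i → proj₂ (proj₂ (next (dart (suc i))))
    }
    where
    next : (d : Dart) → Σ Dart λ d′ → Joins (proj₁ (proj₂ d′)) (proj₁ d) (proj₁ d′)
                                   × proj₁ (proj₂ d′) ≢ proj₁ (proj₂ d)
    next (v , e , v∈e) =
      let f , v∈f , f≢e = anotherEdge v∈e (leafless v e)
          w , joins     = incident⇒Joins v∈f
      in (w , f , Joins⇒incident joins) , joins , f≢e
    dart : ℕ → Dart
    dart zero    = start
    dart (suc i) = proj₁ (next (dart i))

  acyclic⇒pendantEdge : Acyclic G → ∀ {v e} → incident G v e ≡ true → ∃₂ PendantEdge
  acyclic⇒pendantEdge acyclic {v} {e} v∈e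
    with any? (λ u → any? (λ f → pendantEdge? u f))
  ... | yes pendant = pendant
  ... | no  leafless =
    ⊥-elim (acyclic (walk⇒cycle (leaflessWalk (λ u f p → leafless (u , f , p)) (v , e , v∈e))))

  perfectMatching-covers : ∀ {M} → IsPerfectMatching G M → ∀ v →
                           ∃ λ e → M e ≡ true × incident G v e ≡ true
  perfectMatching-covers {M} pm v =
    let e , Me∧v∈e = countB≡1⇒∃ (pm v)
    in e , ∧-conicalˡ (M e) _ Me∧v∈e , ∧-conicalʳ (M e) _ Me∧v∈e

  pendantEdge∈perfectMatching : ∀ {v e M} → PendantEdge v e → IsPerfectMatching G M → M e ≡ true
  pendantEdge∈perfectMatching (_ , onlyE) pm with perfectMatching-covers pm _
  ... | f , Mf , v∈f with onlyE f v∈f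
  ...   | refl = Mf

  isPerfectMatching? : ∀ M → Dec (IsPerfectMatching G M)
  isPerfectMatching? M = all? (λ v → countB (λ e → M e ∧ incident G v e) ℕ.≟ 1)

  perfectMatching? : Dec (∃ (IsPerfectMatching G))
  perfectMatching? with anySubset? (λ S → isPerfectMatching? (lookup S))
  ... | yes (S , pm) = yes (lookup S , pm)
  ... | no  none     = no λ (M , pm) → none (tabulate M , λ v →
          trans (countB-cong (λ e → cong (_∧ incident G v e) (lookup∘tabulate M e))) (pm v))

  noPerfectMatching⇒IsMP0 : ¬ ∃ (IsPerfectMatching G) → IsMP G 0
  noPerfectMatching⇒IsMP0 none =
    ((λ _ → false) , (λ M pm → ⊥-elim (none (M , pm))) , countB-false {m}) , λ _ _ → z≤n

  noPerfectMatching⇒IsMPf0 : ¬ ∃ (IsPerfectMatching G) → IsMPf G 0ℚ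
  noPerfectMatching⇒IsMPf0 none =
    ((λ _ → 0ℚ) , ((λ M pm → ⊥-elim (none (M , pm))) , λ _ → ℚP.≤-refl) , sumℚ-zero {m})
    , λ y (_ , y≥0) → sumℚ-nonneg y≥0

  InEveryPerfectMatching : Fin m → Set
  InEveryPerfectMatching e = ∀ M → IsPerfectMatching G M → M e ≡ true

  inEveryPerfectMatching⇒IsMP1 : ∀ {M₀ e} → IsPerfectMatching G M₀ →
                                 InEveryPerfectMatching e → IsMP G 1
  inEveryPerfectMatching⇒IsMP1 {M₀} {e} pm₀ forced =
    ((λ x → does (e Fin.≟ x)) , precludes , countB-singleton e) , atLeastOne
    where
    precludes : Precludes G (λ x → does (e Fin.≟ x))
    precludes M pm = e , forced M pm , dec-true (e Fin.≟ e) refl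
    atLeastOne : ∀ S → Precludes G S → 1 ≤ countB S
    atLeastOne S precl = let f , _ , Sf = precl M₀ pm₀ in 1≤countB f Sf

  inEveryPerfectMatching⇒IsMPf1 : ∀ {M₀ e} → IsPerfectMatching G M₀ →
                                  InEveryPerfectMatching e → IsMPf G 1ℚ
  inEveryPerfectMatching⇒IsMPf1 {M₀} {e} pm₀ forced =
    (indicator e , (feasible , indicator-nonneg e) , sumℚ-indicator e) , atLeastOne
    where
    feasible : ∀ M → IsPerfectMatching G M → 1ℚ ℚ.≤ dotInc M (indicator e)
    feasible M pm = ℚP.≤-reflexive (sym (dotInc-indicator M (forced M pm)))
    atLeastOne : ∀ y → FeasibleMPf G y → 1ℚ ℚ.≤ sumℚ y
    atLeastOne y (covers , y≥0) = ℚP.≤-trans (covers M₀ pm₀) (dotInc≤sumℚ M₀ y≥0)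

corollary3p10 : ∀ {n m} (T : Graph n m) → IsTree T → Even n
                → ∃[ k ] (IsMP T k × IsMPf T (ℕtoℚ k))
corollary3p10 T (1≤n , _ , acyclic) _ with perfectMatching? T
... | no none = 0 , noPerfectMatching⇒IsMP0 T none , noPerfectMatching⇒IsMPf0 T none
... | yes (M₀ , pm₀) =
  let _ , _ , v₀∈e₀ = perfectMatching-covers T pm₀ (fromℕ< 1≤n)
      _ , _ , pendant = acyclic⇒pendantEdge T acyclic v₀∈e₀
      forced = λ M pm → pendantEdge∈perfectMatching T pendant pm
  in 1 , inEveryPerfectMatching⇒IsMP1 T pm₀ forced , inEveryPerfectMatching⇒IsMPf1 T pm₀ forced
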